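{- Let $A$ be a finite set of prisoners with $|A|\ge 2$, let $(K,+)$ be an abelian group with $|K|\ge 2$ (the set of colors), let $V$ be a visibility graph on $A$, and let $I$ be an inning function on $A$ with $IN\ge 2$. Suppose the hat game $\mathcal{G}=(A,K,V,I)$ satisfies: (S1) exactly one prisoner declares in the first inning, i.e. $|I_1|=1$; (S2) for every $a\in A$, $V(a)\cup H(a)=A\setminus\{a\}$. Then there is a predictor $P$ for $\mathcal{G}$ such that for every coloring $f\in K^A$, at most one prisoner guesses incorrectly, i.e. $|\{a\in A: P(f)(a)\neq f(a)\}|\le 1$.
   Context: A hat game $(A,K,V,I)$ consists of: a set $A$ of prisoners and a set $K$ of colors (with $|A|,|K|\ge2$); a visibility graph $V\subseteq A^2$ with no loops ($(a,a)\notin V$), where $(a,b)\in V$ means $a$ sees $b$'s hat, and $V(a)=\{b:(a,b)\in V\}$; and an inning function $I$, a surjection from $A$ onto $\{\beta: 1\le\beta\le\alpha\}$ for some nonzero ordinal $\alpha$. Write $IN=\max\operatorname{ran}(I)$, $I_\beta=\{a: I(a)=\beta\}$, $I_{n- }=\bigcup_{n\le\beta\le IN} I_\beta$, and $H(a)=\{b: I(b)<I(a)\}$ (prisoners whose declarations $a$ hears). A coloring is $f\in K^A$. Strategies: for each $a$, a function $S_a:K^{H(a)}\times K^{V(a)}\to K$ (when $H(a)=\emptyset$ this is just a function of the view); the guess $\sigma_a(f)$ is defined by recursion on $I(a)$ as $\sigma_a(f)=S_a(h_a^f, f\restriction V(a))$ where $h_a^f=(\sigma_b(f))_{b\in H(a)}$.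 A predictor is a map $P:K^A\to K^A$ of the form $P(f)(a)=\sigma_a(f)$ for some family of strategies. Prisoner $a$ guesses correctly under $f$ if $P(f)(a)=f(a)$. -}

module Defs where

open import Data.Nat using (ℕ; _<_; _≤_)
open import Data.Nat.Induction using (<-rec)
open import Data.Fin using (Fin)
open import Relation.Binary.PropositionalEquality using (_≡_; refl; subst)

-- Prisoners: A = Fin n.  Colours: a type K.
-- Visibility graph: V a b  means  "a sees b's hat".
-- Inning function: I : Fin n → ℕ (values in 1 … IN, see Statement).
-- H(a) = { b | I b < I a }.

-- A strategy for prisoner a: a function of the heard declarations
-- (a colour for every b ∈ H(a)) and of the view (f restricted to V(a)).
Strategies : (n : ℕ) (K : Set) (V : Fin n → Fin n → Set) (I : Fin n → ℕ) → Set
Strategies n K V I =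
  (a : Fin n) → ((b : Fin n) → I b < I a → K) → ((b : Fin n) → V a b → K) → K

guess : {n : ℕ} {K : Set} {V : Fin n → Fin n → Set} {I : Fin n → ℕ} →
        Strategies n K V I → (Fin n → K) → Fin n → K
guess {n} {K} {V} {I} S f a = <-rec P step (I a) a refl
  where
  P : ℕ → Set
  P m = (a : Fin n) → I a ≡ m → K
  step : (m : ℕ) → ({k : ℕ} → k < m → P k) → P m
  step m rec a eq =
    S a (λ b lt → rec {I b} (subst (λ x → I b < x) eq lt) b refl)
        (λ b _ → f b)

predictor : {n : ℕ} {K : Set} {V : Fin n → Fin n → Set} {I : Fin n → ℕ} →
            Strategies n K V I → (Fin n → K) → (Fin n → K)
predictor S f a = guess S f a

{-# OPTIONS --safe #-}
-- The prisoner of the first inning sees every other hat and declares their sum.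
-- Every later prisoner a hears that sum and knows every hat other than the first
-- prisoner's and its own: hats declared earlier are heard, and earlier declarations
-- are correct by induction on the innings; all remaining hats are seen.  So a
-- recovers its own colour by subtracting the known hats from the announced sum,
-- and only the first prisoner can be wrong.
module Submission where

open import Defs
open import Data.Nat using (ℕ; _<_; _≤_)
open import Data.Fin using (Fin)
open import Data.Product using (Σ; _×_; ∃; _,_)
open import Data.Sum using (_⊎_)
open import Relation.Nullary using (¬_)
open import Relation.Binary.PropositionalEquality using (_≡_; _≢_)
open import Algebra.Structures using (IsAbelianGroup)

open import Algebra.Bundles using (AbelianGroup; CommutativeMonoid)
import Algebra.Properties.CommutativeMonoid.Sum as CommutativeMonoidSum
open import Algebra.Properties.Group using (//-rightDividesʳ)
open import Data.Fin using (_≟_; punchIn)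
open import Data.Fin.Properties using (punchInᵢ≢i)
open import Data.Nat using (zero; suc; _<?_)
open import Data.Nat.Induction using (<-wellFounded)
open import Data.Nat.Properties using (≤∧≢⇒<)
open import Data.Product using (proj₁; proj₂)
open import Data.Sum using (inj₁; inj₂)
open import Data.Vec.Functional using (Vector; updateAt; removeAt)
open import Data.Vec.Functional.Properties using (updateAt-updates; updateAt-minimal)
open import Function using (const; case_of_)
open import Induction.WellFounded using (Acc; acc; module Some)
open import Relation.Nullary using (yes; no; contradiction)
open import Relation.Nullary.Decidable using (decidable-stable)
open import Relation.Binary.PropositionalEquality
  using (refl; sym; trans; cong; subst; module ≡-Reasoning)

module _ {n : ℕ} {K : Set} {V : Fin n → Fin n → Set} {I : Fin n → ℕ}
         (S : Strategies n K V I) (f : Fin n → K) where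

  -- The recursion step of guess, repeated so that guess S f a unfolds to it.
  private
    Guesses : ℕ → Set
    Guesses m = (a : Fin n) → I a ≡ m → K

    step : (m : ℕ) → ({k : ℕ} → k < m → Guesses k) → Guesses m
    step m rec a eq =
      S a (λ b lt → rec {I b} (subst (λ x → I b < x) eq lt) b refl) (λ b _ → f b)

  guess-induction : (Q : Fin n → K → Set) →
    ((a : Fin n) (h : (b : Fin n) → I b < I a → K) →
      ((b : Fin n) (lt : I b < I a) → Q b (h b lt)) → Q a (S a h (λ b _ → f b))) →
    (a : Fin n) → Q a (guess S f a)
  guess-induction Q ind a = go (<-wellFounded (I a)) a refl
    where
    go : {m : ℕ} (q : Acc _<_ m) (a : Fin n) (e : I a ≡ m) →
         Q a (step m (Some.wfRecBuilder Guesses step m q) a e)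
    go (acc rs) a e = ind a _ (λ b lt → go (rs _) b refl)

module _ {c ℓ} (M : CommutativeMonoid c ℓ) where

  open CommutativeMonoid M renaming (_∙_ to _+_; ε to 0#)
  open CommutativeMonoidSum M using (sum; sum-remove; sum-cong-≋)
  open import Relation.Binary.Reasoning.Setoid setoid

  sum-extract : {m : ℕ} {t u : Vector Carrier m} (i : Fin m) → u i ≈ 0# →
    ((j : Fin m) → j ≢ i → t j ≈ u j) → sum t ≈ t i + sum u
  sum-extract {zero} () _ _
  sum-extract {suc m} {t} {u} i ui≈0 t≈u = begin
    sum t                             ≈⟨ sum-remove {i = i} t ⟩
    t i + sum (removeAt t i)          ≈⟨ ∙-congˡ (sum-cong-≋ t≈u-off-i) ⟩
    t i + sum (removeAt u i)          ≈⟨ ∙-congˡ (identityˡ _) ⟨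
    t i + (0# + sum (removeAt u i))   ≈⟨ ∙-congˡ (∙-congʳ ui≈0) ⟨
    t i + (u i + sum (removeAt u i))  ≈⟨ ∙-congˡ (sum-remove {i = i} u) ⟨
    t i + sum u                       ∎
    where
    t≈u-off-i : (j : Fin m) → removeAt t i j ≈ removeAt u i j
    t≈u-off-i j = t≈u (punchIn i j) (punchInᵢ≢i i j)

module SumOfOthersStrategy
  {n : ℕ} {K : Set} {_+_ : K → K → K} {0# : K} { -_ : K → K}
  (isAbelianGroup : IsAbelianGroup _≡_ _+_ 0# -_)
  (V : Fin n → Fin n → Set) (I : Fin n → ℕ)
  (a₀ : Fin n) (a₀-first : {a : Fin n} → a ≢ a₀ → I a₀ < I a)
  (seen-or-heard : (a b : Fin n) → b ≢ a → V a b ⊎ I b < I a) where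

  abelianGroup : AbelianGroup _ _
  abelianGroup = record { isAbelianGroup = isAbelianGroup }

  open AbelianGroup abelianGroup using (commutativeMonoid; group)
  open CommutativeMonoidSum commutativeMonoid using (sum; sum-cong-≗)

  Heard Seen : Fin n → Set
  Heard a = (b : Fin n) → I b < I a → K
  Seen a = (b : Fin n) → V a b → K

  view : Vector K n → (a : Fin n) → Seen a
  view f a b _ = f b

  seen : {a b : Fin n} → b ≢ a → ¬ I b < I a → V a b
  seen {a} {b} b≢a b≮a with seen-or-heard a b b≢a
  ... | inj₁ a-sees-b = a-sees-b
  ... | inj₂ b<a = contradiction b<a b≮a

  known : (a : Fin n) → Heard a → Seen a → Vector K n
  known a h v b with b ≟ a₀ | b ≟ a
  ... | yes _ | _ = 0#
  ... | no _ | yes _ = 0#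
  ... | no _ | no b≢a with I b <? I a
  ...   | yes b<a = h b b<a
  ...   | no b≮a = v b (seen b≢a b≮a)

  strategy : Strategies n K V I
  strategy a h v with a ≟ a₀
  ... | yes _ = sum (known a h v)
  ... | no a≢a₀ = h a₀ (a₀-first a≢a₀) + (- sum (known a h v))

  total : Vector K n → K
  total f = sum (updateAt f a₀ (const 0#))

  planned : Vector K n → Vector K n
  planned f a with a ≟ a₀
  ... | yes _ = total f
  ... | no _ = f a

  planned-a₀ : (f : Vector K n) → planned f a₀ ≡ total f
  planned-a₀ f with a₀ ≟ a₀
  ... | yes _ = refl
  ... | no a₀≢a₀ = contradiction refl a₀≢a₀

  planned-off-a₀ : (f : Vector K n) {a : Fin n} → a ≢ a₀ → planned f a ≡ f a
  planned-off-a₀ f {a} a≢a₀ with a ≟ a₀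
  ... | yes a≡a₀ = contradiction a≡a₀ a≢a₀
  ... | no _ = refl

  known-self : (a : Fin n) (h : Heard a) (v : Seen a) → known a h v a ≡ 0#
  known-self a h v with a ≟ a₀ | a ≟ a
  ... | yes _ | _ = refl
  ... | no _ | yes _ = refl
  ... | no _ | no a≢a = contradiction refl a≢a

  module _ (f : Vector K n) {a : Fin n} {h : Heard a}
           (h-planned : (b : Fin n) (b<a : I b < I a) → h b b<a ≡ planned f b) where

    known-off-self : (b : Fin n) → b ≢ a → known a h (view f a) b ≡ updateAt f a₀ (const 0#) b
    known-off-self b b≢a with b ≟ a₀ | b ≟ a
    ... | yes refl | _ = sym (updateAt-updates a₀ f)
    ... | no _ | yes b≡a = contradiction b≡a b≢a
    ... | no b≢a₀ | no _ with I b <? I a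
    ...   | yes b<a = trans (h-planned b b<a)
                        (trans (planned-off-a₀ f b≢a₀) (sym (updateAt-minimal b a₀ f b≢a₀)))
    ...   | no _ = sym (updateAt-minimal b a₀ f b≢a₀)

    strategy-planned : strategy a h (view f a) ≡ planned f a
    strategy-planned with a ≟ a₀
    ... | yes refl = sum-cong-≗ known≗f-without-a₀
      where
      known≗f-without-a₀ : (b : Fin n) → known a₀ h (view f a₀) b ≡ updateAt f a₀ (const 0#) b
      known≗f-without-a₀ b = case b ≟ a₀ of λ where
        (yes refl) → trans (known-self a₀ h (view f a₀)) (sym (updateAt-updates a₀ f))
        (no b≢a₀) → known-off-self b b≢a₀
    ... | no a≢a₀ = begin
      h a₀ _ + (- s)
        ≡⟨ cong (_+ (- s)) (trans (h-planned a₀ _) (planned-a₀ f)) ⟩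
      total f + (- s)
        ≡⟨ cong (_+ (- s)) total-split ⟩
      (updateAt f a₀ (const 0#) a + s) + (- s)
        ≡⟨ //-rightDividesʳ group s _ ⟩
      updateAt f a₀ (const 0#) a
        ≡⟨ updateAt-minimal a a₀ f a≢a₀ ⟩
      f a
        ∎
      where
      open ≡-Reasoning
      s = sum (known a h (view f a))
      total-split : total f ≡ updateAt f a₀ (const 0#) a + s
      total-split = sum-extract commutativeMonoid a (known-self a h (view f a))
                      (λ b b≢a → sym (known-off-self b b≢a))

  strategy-follows-plan : (f : Vector K n) (a : Fin n) → guess strategy f a ≡ planned f a
  strategy-follows-plan f =
    guess-induction strategy f (λ a x → x ≡ planned f a) (λ a h → strategy-planned f)

  correct-off-a₀ : (f : Vector K n) {a : Fin n} → a ≢ a₀ → predictor strategy f a ≡ f a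
  correct-off-a₀ f {a} a≢a₀ = trans (strategy-follows-plan f a) (planned-off-a₀ f a≢a₀)

  wrong⇒a₀ : (f : Vector K n) (a : Fin n) → predictor strategy f a ≢ f a → a ≡ a₀
  wrong⇒a₀ f a wrong = decidable-stable (a ≟ a₀) (λ a≢a₀ → wrong (correct-off-a₀ f a≢a₀))

lemma4p1 : (n : ℕ) → 2 ≤ n →
    (K : Set) (_+_ : K → K → K) (0# : K) (-_ : K → K) →
    IsAbelianGroup _≡_ _+_ 0# -_ →
    Σ K (λ x → Σ K (λ y → x ≢ y)) →
    (V : Fin n → Fin n → Set) → ((a : Fin n) → ¬ V a a) →
    (I : Fin n → ℕ) (IN : ℕ) →
    ((a : Fin n) → 1 ≤ I a × I a ≤ IN) →
    ((β : ℕ) → 1 ≤ β → β ≤ IN → ∃ (λ a → I a ≡ β)) →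
    2 ≤ IN →
    ∃ (λ a → I a ≡ 1 × ((b : Fin n) → I b ≡ 1 → b ≡ a)) →
    ((a b : Fin n) → ((V a b ⊎ I b < I a) → b ≢ a) × (b ≢ a → (V a b ⊎ I b < I a))) →
    Σ (Strategies n K V I) (λ S → (f : Fin n → K) (a b : Fin n) →
      predictor S f a ≢ f a → predictor S f b ≢ f b → a ≡ b)
lemma4p1 n _ K _+_ 0# -_ G _ V _ I _ bounds _ _ (a₀ , I-a₀≡1 , only-a₀) vis =
  strategy , λ f a b wrong-a wrong-b → trans (wrong⇒a₀ f a wrong-a) (sym (wrong⇒a₀ f b wrong-b))
  where
  a₀-first : {a : Fin n} → a ≢ a₀ → I a₀ < I a
  a₀-first {a} a≢a₀ = subst (_< I a) (sym I-a₀≡1)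
    (≤∧≢⇒< (proj₁ (bounds a)) (λ 1≡I-a → a≢a₀ (only-a₀ a (sym 1≡I-a))))

  open SumOfOthersStrategy G V I a₀ a₀-first (λ a b → proj₂ (vis a b))
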